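{- For $a,c\in\mathbb{Z}_{\ge 0}$, we have \begin{align*} z^a_1z_2\sqcup\!\sqcup\, z^c_1 &=\sum^{c}_{k=0}\binom{a+c-k+1}{c-k}z^{a+c-k}_1z_2z^{k}_1,\\ z^a_1z_2z^c_1 &=\sum^{c}_{k=0}\frac{(-1)^{c-k}}{k!}\binom{a+c-k+1}{c-k}z^{a+c-k}_1z_2\sqcup\!\sqcup\, z^{\sqcup\!\sqcup\,k}_1. \end{align*}
   Context: Let $\mathfrak{H}=\mathbb{Q}\langle e_0,e_1\rangle$ be the Hoffman algebra (noncommutative polynomials in $e_0,e_1$ over $\mathbb{Q}$), $\mathfrak{H}^1=\mathbb{Q}+e_1\mathfrak{H}$, and $z_k:=e_1e_0^{k-1}$ for $k\in\mathbb{N}$. $\sqcup\!\sqcup$ denotes the shuffle product on $\mathfrak{H}^1$, and $z_1^{\sqcup\!\sqcup\,k}=z_1\sqcup\!\sqcup\cdots\sqcup\!\sqcup\, z_1$ ($k$ factors), while $z_1^a$ denotes the ordinary (concatenation) power. -}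

module Defs where

open import Data.Nat using (ℕ; zero; suc; _∸_; _!)
open import Data.Nat.Properties using (_!≢0)
open import Data.Nat.Combinatorics using (_C_)
open import Data.Integer using (ℤ; +_)
open import Data.Rational using (ℚ; 0ℚ; 1ℚ; _*_; -_; _+_; _/_)
open import Data.List using (List; []; _∷_; _++_; replicate; concat; map)
open import Data.Product using (_×_; _,_)
open import Data.Bool using (if_then_else_)
open import Relation.Nullary using (Dec; yes; no; does)
open import Relation.Binary.PropositionalEquality using (_≡_; refl)
open import Data.List.Properties using (≡-dec)

data Letter : Set where
  e₀ e₁ : Letter

_≟L_ : (x y : Letter) → Dec (x ≡ y)
e₀ ≟L e₀ = yes refl
e₁ ≟L e₁ = yes refl
e₀ ≟L e₁ = no λ ()
e₁ ≟L e₀ = no λ ()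

Word : Set
Word = List Letter

_≟W_ : (u v : Word) → Dec (u ≡ v)
_≟W_ = ≡-dec _≟L_

-- Elements of ℌ: finite formal ℚ-linear combinations of words
Poly : Set
Poly = List (ℚ × Word)

coeff : Poly → Word → ℚ
coeff [] w = 0ℚ
coeff ((q , u) ∷ p) w = (if does (u ≟W w) then q else 0ℚ) + coeff p w

infix 4 _≈_
_≈_ : Poly → Poly → Set
p ≈ q = (w : Word) → coeff p w ≡ coeff q w

⟦_⟧ : Word → Poly
⟦ w ⟧ = (1ℚ , w) ∷ []

infixr 7 _·_
_·_ : ℚ → Poly → Poly
q · p = map (λ { (r , w) → (q * r , w) }) p

prefix : Letter → Poly → Poly
prefix x p = map (λ { (r , w) → (r , x ∷ w) }) p

shW : Word → Word → Poly
shW [] v = ⟦ v ⟧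
shW (x ∷ u) [] = ⟦ x ∷ u ⟧
shW (x ∷ u) (y ∷ v) = prefix x (shW u (y ∷ v)) ++ prefix y (shW (x ∷ u) v)

infixl 6 _⧢_
_⧢_ : Poly → Poly → Poly
p ⧢ q = concat (map (λ { (r , u) → concat (map (λ { (s , v) → (r * s) · shW u v }) q) }) p)

z : ℕ → Word
z k = e₁ ∷ replicate (k ∸ 1) e₀

z₁^ : ℕ → Word
z₁^ a = concat (replicate a (z 1))

z₁^⧢ : ℕ → Poly
z₁^⧢ zero = ⟦ [] ⟧
z₁^⧢ (suc k) = ⟦ z 1 ⟧ ⧢ z₁^⧢ k

sumTo : ℕ → (ℕ → Poly) → Poly
sumTo zero f = f 0
sumTo (suc c) f = sumTo c f ++ f (suc c)

sgn : ℕ → ℚ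
sgn zero = 1ℚ
sgn (suc n) = - sgn n

inv! : ℕ → ℚ
inv! k = (+ 1 / (k !)) {{k !≢0}}

binQ : ℕ → ℕ → ℚ
binQ n k = (+ (n C k)) / 1

-- Every word involved has the form e₁^i e₀ e₁^j (z₁^a z₂ z₁^c = e₁^(a+1) e₀ e₁^c), so both sides are
-- compared through their coefficient functions (i, j) ↦ F i j. Shuffling e₁^m e₀ with e₁^c yields
-- e₁^i e₀ e₁^j, for each i + j = m + c, exactly (i choose m) times (Pascal's rule), and z₁^{⧢k} = k! z₁^k.
-- The first identity is then the symmetry C(a+c-k+1, c-k) = C(a+c-k+1, a+1). For the second, the
-- coefficient of e₁^i e₀ e₁^j (i + j = a + c + 1) on the right is, after reversing the summation index
-- and a trinomial revision, Σ_{l ≤ c} (-1)^l C(a+l+1, l) C(i, a+l+1) = C(i, a+1) Σ_{l ≤ c} (-1)^l C(i-a-1, l);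
-- this partial alternating sum is 1 when i = a + 1 and (-1)^c C(i-a-2, c) = 0 otherwise, since i-a-2 < c.

module Submission where

open import Defs
open import Data.Nat as ℕ using (ℕ; zero; suc; _+_; _∸_; _!; _≤_; _<_; z≤n; s≤s)
import Data.Nat.Properties as ℕ
open import Data.Nat.Combinatorics
  using (_C_; nCn≡1; k>n⇒nCk≡0; nCk≡nC[n∸k]; nCk≡n!/k![n-k]!; k![n∸k]!∣n!; nCk+nC[k+1]≡[n+1]C[k+1])
open import Data.Nat.Coprimality using (1-coprimeTo) renaming (sym to coprime-sym)
open import Data.Nat.DivMod using (m/n*n≡m)
open import Data.Nat.Tactic.RingSolver using (solve-∀)
import Data.Integer as ℤ
import Data.Integer.Properties as ℤ
open import Data.Rational as ℚ using (ℚ; 0ℚ; 1ℚ; _*_; -_; mkℚ; toℚᵘ)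
import Data.Rational.Properties as ℚ
open import Data.Rational.Solver using (module +-*-Solver)
import Data.Rational.Unnormalised as ℚᵘ
import Data.Rational.Unnormalised.Properties as ℚᵘ
open import Data.List using ([]; _∷_; _++_; replicate)
open import Data.List.Properties using (++-assoc)
open import Data.Product using (_×_; _,_)
open import Data.Bool using (true; false; if_then_else_)
open import Function using (_∘_)
open import Relation.Nullary using (Dec; does; yes; no; ¬_)
open import Relation.Nullary.Decidable using (dec-true; dec-false)
open import Relation.Binary.PropositionalEquality

-- Opaque, so that unification never unfolds the normalising division on ℚ.
opaque
  fromℕ : ℕ → ℚ
  fromℕ n = ℤ.+ n ℚ./ 1

  fromℕ≡mkℚ : ∀ n → fromℕ n ≡ mkℚ (ℤ.+ n) 0 (coprime-sym (1-coprimeTo n))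
  fromℕ≡mkℚ n = ℚ.normalize-coprime (coprime-sym (1-coprimeTo n))

  binQ≡fromℕ : ∀ n k → binQ n k ≡ fromℕ (n C k)
  binQ≡fromℕ n k = refl

fromℕ-0 : fromℕ 0 ≡ 0ℚ
fromℕ-0 = fromℕ≡mkℚ 0

fromℕ-1 : fromℕ 1 ≡ 1ℚ
fromℕ-1 = fromℕ≡mkℚ 1

toℚᵘ-fromℕ : ∀ n → toℚᵘ (fromℕ n) ≡ ℚᵘ.mkℚᵘ (ℤ.+ n) 0
toℚᵘ-fromℕ n = cong toℚᵘ (fromℕ≡mkℚ n)

fromℕ-+ : ∀ m n → fromℕ (m + n) ≡ fromℕ m ℚ.+ fromℕ n
fromℕ-+ m n = ℚ.toℚᵘ-injective (begin
  toℚᵘ (fromℕ (m + n))                      ≡⟨ toℚᵘ-fromℕ (m + n) ⟩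
  ℚᵘ.mkℚᵘ (ℤ.+ (m + n)) 0                   ≈⟨ ℚᵘ.*≡* (cong (ℤ._* ℤ.+ 1)
                                                  (sym (cong₂ ℤ._+_ (ℤ.*-identityʳ (ℤ.+ m)) (ℤ.*-identityʳ (ℤ.+ n))))) ⟩
  ℚᵘ.mkℚᵘ (ℤ.+ m) 0 ℚᵘ.+ ℚᵘ.mkℚᵘ (ℤ.+ n) 0 ≡⟨ sym (cong₂ ℚᵘ._+_ (toℚᵘ-fromℕ m) (toℚᵘ-fromℕ n)) ⟩
  toℚᵘ (fromℕ m) ℚᵘ.+ toℚᵘ (fromℕ n)        ≈⟨ ℚᵘ.≃-sym (ℚ.toℚᵘ-homo-+ (fromℕ m) (fromℕ n)) ⟩
  toℚᵘ (fromℕ m ℚ.+ fromℕ n)                ∎)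
  where open import Relation.Binary.Reasoning.Setoid ℚᵘ.≃-setoid

fromℕ-* : ∀ m n → fromℕ (m ℕ.* n) ≡ fromℕ m * fromℕ n
fromℕ-* m n = ℚ.toℚᵘ-injective (begin
  toℚᵘ (fromℕ (m ℕ.* n))                    ≡⟨ toℚᵘ-fromℕ (m ℕ.* n) ⟩
  ℚᵘ.mkℚᵘ (ℤ.+ (m ℕ.* n)) 0                 ≈⟨ ℚᵘ.*≡* (cong (ℤ._* ℤ.+ 1) (ℤ.pos-* m n)) ⟩
  ℚᵘ.mkℚᵘ (ℤ.+ m) 0 ℚᵘ.* ℚᵘ.mkℚᵘ (ℤ.+ n) 0 ≡⟨ sym (cong₂ ℚᵘ._*_ (toℚᵘ-fromℕ m) (toℚᵘ-fromℕ n)) ⟩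
  toℚᵘ (fromℕ m) ℚᵘ.* toℚᵘ (fromℕ n)        ≈⟨ ℚᵘ.≃-sym (ℚ.toℚᵘ-homo-* (fromℕ m) (fromℕ n)) ⟩
  toℚᵘ (fromℕ m * fromℕ n)                  ∎)
  where open import Relation.Binary.Reasoning.Setoid ℚᵘ.≃-setoid

inv!-*-fromℕ! : ∀ k → inv! k * fromℕ (k !) ≡ 1ℚ
inv!-*-fromℕ! k with k ! | k ℕ.!≢0
... | suc d | _ = begin
  (ℤ.+ 1 ℚ./ suc d) * fromℕ (suc d) ≡⟨ cong₂ _*_ (ℚ.normalize-coprime (1-coprimeTo (suc d))) (fromℕ≡mkℚ (suc d)) ⟩
  ℚ.1/ n * n                        ≡⟨ ℚ.*-inverseˡ n ⟩
  1ℚ                                ∎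
  where
  open ≡-Reasoning
  n = mkℚ (ℤ.+ suc d) 0 (coprime-sym (1-coprimeTo (suc d)))

when : {P : Set} → Dec P → ℚ → ℚ
when d x = if does d then x else 0ℚ

module _ {P : Set} (d : Dec P) (x : ℚ) where

  when-yes : P → when d x ≡ x
  when-yes p = cong (if_then x else 0ℚ) (dec-true d p)

  when-no : ¬ P → when d x ≡ 0ℚ
  when-no ¬p = cong (if_then x else 0ℚ) (dec-false d ¬p)

  when-+ : ∀ y → when d x ℚ.+ when d y ≡ when d (x ℚ.+ y)
  when-+ y with does d
  ... | true  = refl
  ... | false = refl

  when-*ˡ : ∀ r → when d (r * x) ≡ r * when d x
  when-*ˡ r with does d
  ... | true  = refl
  ... | false = sym (ℚ.*-zeroʳ r)

when-0 : {P : Set} (d : Dec P) → when d 0ℚ ≡ 0ℚ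
when-0 d with does d
... | true  = refl
... | false = refl

when-≡ : {P Q : Set} (d : Dec P) (e : Dec Q) (x : ℚ) → (P → Q) → (Q → P) → when d x ≡ when e x
when-≡ (yes p) e x p→q q→p = sym (when-yes e x (p→q p))
when-≡ (no ¬p) e x p→q q→p = sym (when-no e x (¬p ∘ q→p))

sumToℚ : ℕ → (ℕ → ℚ) → ℚ
sumToℚ zero f = f 0
sumToℚ (suc c) f = sumToℚ c f ℚ.+ f (suc c)

sumToℚ-cong : ∀ c {f g : ℕ → ℚ} → (∀ k → k ≤ c → f k ≡ g k) → sumToℚ c f ≡ sumToℚ c g
sumToℚ-cong zero f≡g = f≡g 0 z≤n
sumToℚ-cong (suc c) f≡g =
  cong₂ ℚ._+_ (sumToℚ-cong c (λ k k≤c → f≡g k (ℕ.m≤n⇒m≤1+n k≤c))) (f≡g (suc c) ℕ.≤-refl)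

sumToℚ-zero : ∀ c {f : ℕ → ℚ} → (∀ k → k ≤ c → f k ≡ 0ℚ) → sumToℚ c f ≡ 0ℚ
sumToℚ-zero c f≡0 = trans (sumToℚ-cong c f≡0) (sumToℚ-const0 c)
  where
  sumToℚ-const0 : ∀ c → sumToℚ c (λ _ → 0ℚ) ≡ 0ℚ
  sumToℚ-const0 zero = refl
  sumToℚ-const0 (suc c) = cong (ℚ._+ 0ℚ) (sumToℚ-const0 c)

sumToℚ-single : ∀ c j {f : ℕ → ℚ} → j ≤ c → (∀ k → k ≤ c → k ≢ j → f k ≡ 0ℚ) → sumToℚ c f ≡ f j
sumToℚ-single zero zero z≤n _ = refl
sumToℚ-single (suc c) j {f} j≤1+c f≡0 with j ℕ.≟ suc c
... | yes refl = begin
  sumToℚ c f ℚ.+ f (suc c) ≡⟨ cong (ℚ._+ f (suc c)) (sumToℚ-zero c λ k k≤c →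
                                f≡0 k (ℕ.m≤n⇒m≤1+n k≤c) (ℕ.<⇒≢ (s≤s k≤c))) ⟩
  0ℚ ℚ.+ f (suc c)         ≡⟨ ℚ.+-identityˡ (f (suc c)) ⟩
  f (suc c)                ∎
  where open ≡-Reasoning
... | no j≢1+c = begin
  sumToℚ c f ℚ.+ f (suc c) ≡⟨ cong₂ ℚ._+_
                                (sumToℚ-single c j (ℕ.≤-pred (ℕ.≤∧≢⇒< j≤1+c j≢1+c)) λ k k≤c → f≡0 k (ℕ.m≤n⇒m≤1+n k≤c))
                                (f≡0 (suc c) ℕ.≤-refl (j≢1+c ∘ sym)) ⟩
  f j ℚ.+ 0ℚ               ≡⟨ ℚ.+-identityʳ (f j) ⟩
  f j                      ∎
  where open ≡-Reasoning

sumToℚ-*ˡ : ∀ c x (f : ℕ → ℚ) → sumToℚ c (λ k → x * f k) ≡ x * sumToℚ c f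
sumToℚ-*ˡ zero x f = refl
sumToℚ-*ˡ (suc c) x f =
  trans (cong (ℚ._+ x * f (suc c)) (sumToℚ-*ˡ c x f)) (sym (ℚ.*-distribˡ-+ x (sumToℚ c f) (f (suc c))))

sumToℚ-reverse : ∀ c (f : ℕ → ℚ) → sumToℚ c (λ k → f (c ∸ k)) ≡ sumToℚ c f
sumToℚ-reverse zero f = refl
sumToℚ-reverse (suc c) f = begin
  sumToℚ (suc c) (λ k → f (suc c ∸ k))           ≡⟨ sumToℚ-unshift c (λ k → f (suc c ∸ k)) ⟩
  f (suc c) ℚ.+ sumToℚ c (λ k → f (c ∸ k))        ≡⟨ cong (f (suc c) ℚ.+_) (sumToℚ-reverse c f) ⟩
  f (suc c) ℚ.+ sumToℚ c f                       ≡⟨ ℚ.+-comm (f (suc c)) (sumToℚ c f) ⟩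
  sumToℚ (suc c) f                               ∎
  where
  open ≡-Reasoning
  sumToℚ-unshift : ∀ c (g : ℕ → ℚ) → sumToℚ (suc c) g ≡ g 0 ℚ.+ sumToℚ c (λ k → g (suc k))
  sumToℚ-unshift zero g = refl
  sumToℚ-unshift (suc c) g = trans (cong (ℚ._+ g (2 + c)) (sumToℚ-unshift c g)) (ℚ.+-assoc (g 0) _ _)

nCk*[k!*[n∸k]!]≡n! : ∀ {n k} → k ≤ n → (n C k) ℕ.* (k ! ℕ.* (n ∸ k) !) ≡ n !
nCk*[k!*[n∸k]!]≡n! {n} {k} k≤n =
  trans (cong (ℕ._* (k ! ℕ.* (n ∸ k) !)) (nCk≡n!/k![n-k]! k≤n)) (m/n*n≡m (k![n∸k]!∣n! k≤n))
  where instance _ = k ℕ.!* (n ∸ k) !≢0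

-- For n + l ≤ i, both sides times n! l! (i ∸ (n + l))! are i!.
C-trinomial-revision : ∀ n l i → ((n + l) C l) ℕ.* (i C (n + l)) ≡ (i C n) ℕ.* ((i ∸ n) C l)
C-trinomial-revision n l i with n + l ℕ.≤? i
... | yes n+l≤i = ℕ.*-cancelʳ-≡ _ _ (l ! ℕ.* (n ! ℕ.* r !)) {{ℕ.m*n≢0 (l !) _ {{l ℕ.!≢0}} {{n ℕ.!* r !≢0}}}} (begin
  A ℕ.* B ℕ.* (l ! ℕ.* (n ! ℕ.* r !))
    ≡⟨ regroupˡ A B (l !) (n !) (r !) ⟩
  B ℕ.* ((A ℕ.* (l ! ℕ.* n !)) ℕ.* r !)
    ≡⟨ cong (λ m → B ℕ.* ((A ℕ.* (l ! ℕ.* m !)) ℕ.* r !)) (sym (ℕ.m+n∸n≡m n l)) ⟩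
  B ℕ.* ((A ℕ.* (l ! ℕ.* (n + l ∸ l) !)) ℕ.* r !)
    ≡⟨ cong (λ m → B ℕ.* (m ℕ.* r !)) (nCk*[k!*[n∸k]!]≡n! (ℕ.m≤n+m l n)) ⟩
  B ℕ.* ((n + l) ! ℕ.* r !)
    ≡⟨ nCk*[k!*[n∸k]!]≡n! n+l≤i ⟩
  i !
    ≡⟨ nCk*[k!*[n∸k]!]≡n! n≤i ⟨
  X ℕ.* (n ! ℕ.* (i ∸ n) !)
    ≡⟨ cong (λ m → X ℕ.* (n ! ℕ.* m)) (nCk*[k!*[n∸k]!]≡n! l≤i∸n) ⟨
  X ℕ.* (n ! ℕ.* (Y ℕ.* (l ! ℕ.* (i ∸ n ∸ l) !)))
    ≡⟨ cong (λ m → X ℕ.* (n ! ℕ.* (Y ℕ.* (l ! ℕ.* m !)))) (ℕ.∸-+-assoc i n l) ⟩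
  X ℕ.* (n ! ℕ.* (Y ℕ.* (l ! ℕ.* r !)))
    ≡⟨ regroupʳ X Y (l !) (n !) (r !) ⟩
  X ℕ.* Y ℕ.* (l ! ℕ.* (n ! ℕ.* r !)) ∎)
  where
  open ≡-Reasoning
  regroupˡ : ∀ a b x y z → a ℕ.* b ℕ.* (x ℕ.* (y ℕ.* z)) ≡ b ℕ.* ((a ℕ.* (x ℕ.* y)) ℕ.* z)
  regroupˡ = solve-∀
  regroupʳ : ∀ a b x y z → a ℕ.* (y ℕ.* (b ℕ.* (x ℕ.* z))) ≡ a ℕ.* b ℕ.* (x ℕ.* (y ℕ.* z))
  regroupʳ = solve-∀
  r = i ∸ (n + l)
  A = (n + l) C l
  B = i C (n + l)
  X = i C n
  Y = (i ∸ n) C l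
  n≤i : n ≤ i
  n≤i = ℕ.≤-trans (ℕ.m≤m+n n l) n+l≤i
  l≤i∸n : l ≤ i ∸ n
  l≤i∸n = subst (_≤ i ∸ n) (ℕ.m+n∸m≡n n l) (ℕ.∸-monoˡ-≤ n n+l≤i)
... | no n+l≰i = trans (cong (((n + l) C l) ℕ.*_) (k>n⇒nCk≡0 i<n+l)) (trans (ℕ.*-zeroʳ ((n + l) C l)) (sym rhs≡0))
  where
  i<n+l = ℕ.≰⇒> n+l≰i
  rhs≡0 : (i C n) ℕ.* ((i ∸ n) C l) ≡ 0
  rhs≡0 with n ℕ.≤? i
  ... | no n≰i = cong (ℕ._* ((i ∸ n) C l)) (k>n⇒nCk≡0 (ℕ.≰⇒> n≰i))
  ... | yes n≤i = trans (cong ((i C n) ℕ.*_) (k>n⇒nCk≡0 i∸n<l)) (ℕ.*-zeroʳ (i C n))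
    where
    i∸n<l : i ∸ n < l
    i∸n<l = ℕ.+-cancelˡ-< n (i ∸ n) l (subst (_< n + l) (sym (ℕ.m+[n∸m]≡n n≤i)) i<n+l)

C-symmetric : ∀ m d → (m + d) C d ≡ (m + d) C m
C-symmetric m d = trans (nCk≡nC[n∸k] (ℕ.m≤n+m d m)) (cong ((m + d) C_) (ℕ.m+n∸n≡m m d))

alternating-sum-0 : ∀ c → sumToℚ c (λ l → sgn l * fromℕ (0 C l)) ≡ 1ℚ
alternating-sum-0 zero = trans (ℚ.*-identityˡ (fromℕ 1)) fromℕ-1
alternating-sum-0 (suc c) = begin
  sumToℚ c (λ l → sgn l * fromℕ (0 C l)) ℚ.+ sgn (suc c) * fromℕ 0
    ≡⟨ cong₂ ℚ._+_ (alternating-sum-0 c) (cong (sgn (suc c) *_) fromℕ-0) ⟩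
  1ℚ ℚ.+ sgn (suc c) * 0ℚ
    ≡⟨ cong (1ℚ ℚ.+_) (ℚ.*-zeroʳ (sgn (suc c))) ⟩
  1ℚ ∎
  where open ≡-Reasoning

alternating-sum : ∀ d c → sumToℚ c (λ l → sgn l * fromℕ (suc d C l)) ≡ sgn c * fromℕ (d C c)
alternating-sum d zero = refl
alternating-sum d (suc c) = begin
  sumToℚ c (λ l → sgn l * fromℕ (suc d C l)) ℚ.+ (- sgn c) * fromℕ (suc d C suc c)
    ≡⟨ cong₂ (λ x y → x ℚ.+ (- sgn c) * y) (alternating-sum d c)
             (trans (cong fromℕ (sym (nCk+nC[k+1]≡[n+1]C[k+1] d c))) (fromℕ-+ (d C c) (d C suc c))) ⟩
  sgn c * fromℕ (d C c) ℚ.+ (- sgn c) * (fromℕ (d C c) ℚ.+ fromℕ (d C suc c))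
    ≡⟨ solve 3 (λ s x y → s :* x :+ (:- s) :* (x :+ y) := (:- s) :* y) refl (sgn c) (fromℕ (d C c)) (fromℕ (d C suc c)) ⟩
  (- sgn c) * fromℕ (d C suc c) ∎
  where
  open ≡-Reasoning
  open +-*-Solver

e₁^ : ℕ → Word
e₁^ n = replicate n e₁

hook : ℕ → ℕ → Word
hook i j = e₁^ i ++ e₀ ∷ e₁^ j

z₁^≡e₁^ : ∀ n → z₁^ n ≡ e₁^ n
z₁^≡e₁^ zero = refl
z₁^≡e₁^ (suc n) = cong (e₁ ∷_) (z₁^≡e₁^ n)

z₁^z₂z₁^≡hook : ∀ a c → z₁^ a ++ z 2 ++ z₁^ c ≡ hook (suc a) c
z₁^z₂z₁^≡hook zero c = cong (λ w → e₁ ∷ e₀ ∷ w) (z₁^≡e₁^ c)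
z₁^z₂z₁^≡hook (suc a) c = cong (e₁ ∷_) (z₁^z₂z₁^≡hook a c)

coeff-++ : ∀ p q w → coeff (p ++ q) w ≡ coeff p w ℚ.+ coeff q w
coeff-++ [] q w = sym (ℚ.+-identityˡ (coeff q w))
coeff-++ ((r , u) ∷ p) q w = trans (cong (when (u ≟W w) r ℚ.+_) (coeff-++ p q w))
                                   (sym (ℚ.+-assoc (when (u ≟W w) r) (coeff p w) (coeff q w)))

coeff-· : ∀ r p w → coeff (r · p) w ≡ r * coeff p w
coeff-· r [] w = sym (ℚ.*-zeroʳ r)
coeff-· r ((s , u) ∷ p) w = trans (cong₂ ℚ._+_ (when-*ˡ (u ≟W w) s r) (coeff-· r p w))
                                  (sym (ℚ.*-distribˡ-+ r (when (u ≟W w) s) (coeff p w)))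

-- e₁-series g w and hook-series F w are the coefficients of w in the formal series
-- Σⱼ g j · e₁^j and Σᵢⱼ F i j · e₁^i e₀ e₁^j.
e₁-series : (ℕ → ℚ) → Word → ℚ
e₁-series g [] = g 0
e₁-series g (e₁ ∷ w) = e₁-series (g ∘ suc) w
e₁-series g (e₀ ∷ w) = 0ℚ

hook-series : (ℕ → ℕ → ℚ) → Word → ℚ
hook-series F [] = 0ℚ
hook-series F (e₁ ∷ w) = hook-series (F ∘ suc) w
hook-series F (e₀ ∷ w) = e₁-series (F 0) w

e₁-series-cong : ∀ {g h} → (∀ j → g j ≡ h j) → ∀ w → e₁-series g w ≡ e₁-series h w
e₁-series-cong g≡h [] = g≡h 0
e₁-series-cong g≡h (e₁ ∷ w) = e₁-series-cong (g≡h ∘ suc) w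
e₁-series-cong g≡h (e₀ ∷ w) = refl

e₁-series-+ : ∀ g h w → e₁-series g w ℚ.+ e₁-series h w ≡ e₁-series (λ j → g j ℚ.+ h j) w
e₁-series-+ g h [] = refl
e₁-series-+ g h (e₁ ∷ w) = e₁-series-+ (g ∘ suc) (h ∘ suc) w
e₁-series-+ g h (e₀ ∷ w) = refl

e₁-series-*ˡ : ∀ r g w → r * e₁-series g w ≡ e₁-series (λ j → r * g j) w
e₁-series-*ˡ r g [] = refl
e₁-series-*ˡ r g (e₁ ∷ w) = e₁-series-*ˡ r (g ∘ suc) w
e₁-series-*ˡ r g (e₀ ∷ w) = ℚ.*-zeroʳ r

e₁-series-0 : ∀ w → e₁-series (λ _ → 0ℚ) w ≡ 0ℚ
e₁-series-0 [] = refl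
e₁-series-0 (e₁ ∷ w) = e₁-series-0 w
e₁-series-0 (e₀ ∷ w) = refl

hook-series-cong : ∀ {F G} → (∀ i j → F i j ≡ G i j) → ∀ w → hook-series F w ≡ hook-series G w
hook-series-cong F≡G [] = refl
hook-series-cong F≡G (e₁ ∷ w) = hook-series-cong (F≡G ∘ suc) w
hook-series-cong F≡G (e₀ ∷ w) = e₁-series-cong (F≡G 0) w

hook-series-+ : ∀ F G w → hook-series F w ℚ.+ hook-series G w ≡ hook-series (λ i j → F i j ℚ.+ G i j) w
hook-series-+ F G [] = refl
hook-series-+ F G (e₁ ∷ w) = hook-series-+ (F ∘ suc) (G ∘ suc) w
hook-series-+ F G (e₀ ∷ w) = e₁-series-+ (F 0) (G 0) w

hook-series-*ˡ : ∀ r F w → r * hook-series F w ≡ hook-series (λ i j → r * F i j) w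
hook-series-*ˡ r F [] = ℚ.*-zeroʳ r
hook-series-*ˡ r F (e₁ ∷ w) = hook-series-*ˡ r (F ∘ suc) w
hook-series-*ˡ r F (e₀ ∷ w) = e₁-series-*ˡ r (F 0) w

hook-series-0 : ∀ w → hook-series (λ _ _ → 0ℚ) w ≡ 0ℚ
hook-series-0 [] = refl
hook-series-0 (e₁ ∷ w) = hook-series-0 w
hook-series-0 (e₀ ∷ w) = e₁-series-0 w

infix 4 _≈ₕ_
record _≈ₕ_ (p : Poly) (F : ℕ → ℕ → ℚ) : Set where
  constructor coeff≡hook-series
  field coeff-≡ : ∀ w → coeff p w ≡ hook-series F w
open _≈ₕ_

≈ₕ-cong : ∀ {p F G} → (∀ i j → F i j ≡ G i j) → p ≈ₕ F → p ≈ₕ G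
≈ₕ-cong F≡G p≈F = coeff≡hook-series λ w → trans (coeff-≡ p≈F w) (hook-series-cong F≡G w)

≈ₕ-++ : ∀ {p q F G} → p ≈ₕ F → q ≈ₕ G → p ++ q ≈ₕ (λ i j → F i j ℚ.+ G i j)
≈ₕ-++ {p} {q} p≈F q≈G = coeff≡hook-series λ w →
  trans (coeff-++ p q w) (trans (cong₂ ℚ._+_ (coeff-≡ p≈F w) (coeff-≡ q≈G w)) (hook-series-+ _ _ w))

≈ₕ-· : ∀ {p F} r → p ≈ₕ F → r · p ≈ₕ (λ i j → r * F i j)
≈ₕ-· {p} r p≈F = coeff≡hook-series λ w →
  trans (coeff-· r p w) (trans (cong (r *_) (coeff-≡ p≈F w)) (hook-series-*ˡ r _ w))

≈ₕ-sumTo : ∀ c {f : ℕ → Poly} {F : ℕ → ℕ → ℕ → ℚ} →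
           (∀ k → f k ≈ₕ F k) → sumTo c f ≈ₕ (λ i j → sumToℚ c (λ k → F k i j))
≈ₕ-sumTo zero f≈F = f≈F 0
≈ₕ-sumTo (suc c) f≈F = ≈ₕ-++ (≈ₕ-sumTo c f≈F) (f≈F (suc c))

≈ₕ⇒≈ : ∀ {p q F G} → p ≈ₕ F → q ≈ₕ G → (∀ i j → F i j ≡ G i j) → p ≈ q
≈ₕ⇒≈ p≈F q≈G F≡G w = trans (coeff-≡ p≈F w) (trans (hook-series-cong F≡G w) (sym (coeff-≡ q≈G w)))

shift : (ℕ → ℕ → ℚ) → ℕ → ℕ → ℚ
shift F zero j = 0ℚ
shift F (suc i) j = F i j

≈ₕ-prefix : ∀ {p F} → p ≈ₕ F → prefix e₁ p ≈ₕ shift F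
≈ₕ-prefix {p} p≈F = coeff≡hook-series λ where
    []       → coeff-prefix-[] p
    (e₁ ∷ w) → trans (coeff-prefix-e₁ p w) (coeff-≡ p≈F w)
    (e₀ ∷ w) → trans (coeff-prefix-e₀ p w) (sym (e₁-series-0 w))
  where
  coeff-prefix-[] : ∀ p → coeff (prefix e₁ p) [] ≡ 0ℚ
  coeff-prefix-[] [] = refl
  coeff-prefix-[] ((r , u) ∷ p) = trans (ℚ.+-identityˡ _) (coeff-prefix-[] p)
  coeff-prefix-e₁ : ∀ p w → coeff (prefix e₁ p) (e₁ ∷ w) ≡ coeff p w
  coeff-prefix-e₁ [] w = refl
  coeff-prefix-e₁ ((r , u) ∷ p) w = cong (when (u ≟W w) r ℚ.+_) (coeff-prefix-e₁ p w)
  coeff-prefix-e₀ : ∀ p w → coeff (prefix e₁ p) (e₀ ∷ w) ≡ 0ℚ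
  coeff-prefix-e₀ [] w = refl
  coeff-prefix-e₀ ((r , u) ∷ p) w = trans (ℚ.+-identityˡ _) (coeff-prefix-e₀ p w)

δ : ℕ → ℕ → ℕ → ℕ → ℚ
δ p k i j = when (p ℕ.≟ i) (when (k ℕ.≟ j) 1ℚ)

≈ₕ-hook : ∀ p k → ⟦ hook p k ⟧ ≈ₕ δ p k
≈ₕ-hook p k = coeff≡hook-series λ w → trans (ℚ.+-identityʳ _) (hook-indicator p k w)
  where
  e₁^-indicator : ∀ k w → when (e₁^ k ≟W w) 1ℚ ≡ e₁-series (λ j → when (k ℕ.≟ j) 1ℚ) w
  e₁^-indicator zero [] = refl
  e₁^-indicator zero (e₁ ∷ w) = sym (e₁-series-0 w)
  e₁^-indicator zero (e₀ ∷ w) = refl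
  e₁^-indicator (suc k) [] = refl
  e₁^-indicator (suc k) (e₁ ∷ w) = e₁^-indicator k w
  e₁^-indicator (suc k) (e₀ ∷ w) = refl
  hook-indicator : ∀ p k w → when (hook p k ≟W w) 1ℚ ≡ hook-series (δ p k) w
  hook-indicator zero k [] = refl
  hook-indicator zero k (e₁ ∷ w) = sym (hook-series-0 w)
  hook-indicator zero k (e₀ ∷ w) = e₁^-indicator k w
  hook-indicator (suc p) k [] = refl
  hook-indicator (suc p) k (e₁ ∷ w) = hook-indicator p k w
  hook-indicator (suc p) k (e₀ ∷ w) = sym (e₁-series-0 w)

δ-diagonal : ∀ p k → δ p k p k ≡ 1ℚ
δ-diagonal p k = trans (when-yes (p ℕ.≟ p) _ refl) (when-yes (k ℕ.≟ k) 1ℚ refl)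

δ-on : ∀ {p k i j} → p ≡ i → k ≡ j → δ p k i j ≡ 1ℚ
δ-on {p} {k} refl refl = δ-diagonal p k

δ-offˡ : ∀ {p i} k j → p ≢ i → δ p k i j ≡ 0ℚ
δ-offˡ {p} {i} k j p≢i = when-no (p ℕ.≟ i) _ p≢i

δ-offʳ : ∀ p i {k j} → k ≢ j → δ p k i j ≡ 0ℚ
δ-offʳ p i {k} {j} k≢j = trans (cong (when (p ℕ.≟ i)) (when-no (k ℕ.≟ j) 1ℚ k≢j)) (when-0 (p ℕ.≟ i))

δ-column-sum : ∀ c (b : ℕ → ℚ) (p : ℕ → ℕ) i j →
  sumToℚ c (λ k → b k * δ (p k) k i j) ≡ when (j ℕ.≤? c) (b j * δ (p j) j i j)
δ-column-sum c b p i j = by-cases (j ℕ.≤? c)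
  where
  off-column : ∀ k → k ≢ j → b k * δ (p k) k i j ≡ 0ℚ
  off-column k k≢j = trans (cong (b k *_) (δ-offʳ (p k) i k≢j)) (ℚ.*-zeroʳ (b k))
  by-cases : (d : Dec (j ≤ c)) → sumToℚ c (λ k → b k * δ (p k) k i j) ≡ when d (b j * δ (p j) j i j)
  by-cases (yes j≤c) = sumToℚ-single c j j≤c λ k _ → off-column k
  by-cases (no j≰c) = sumToℚ-zero c λ k k≤c → off-column k λ k≡j → j≰c (subst (_≤ c) k≡j k≤c)

≈ₕ-z₁^z₂z₁^ : ∀ a c → ⟦ z₁^ a ++ z 2 ++ z₁^ c ⟧ ≈ₕ δ (suc a) c
≈ₕ-z₁^z₂z₁^ a c = subst (λ u → ⟦ u ⟧ ≈ₕ δ (suc a) c) (sym (z₁^z₂z₁^≡hook a c)) (≈ₕ-hook (suc a) c)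

-- The coefficient of e₁^i e₀ e₁^j in e₁^m e₀ ⧢ e₁^c: choose which of the i letters before e₀ come from e₁^m.
shuffle-coeff : ℕ → ℕ → ℕ → ℕ → ℚ
shuffle-coeff m c i j = when (i + j ℕ.≟ m + c) (fromℕ (i C m))

shuffle-coeff-0-0 : ∀ i j → δ 0 0 i j ≡ shuffle-coeff 0 0 i j
shuffle-coeff-0-0 zero zero = sym fromℕ-1
shuffle-coeff-0-0 zero (suc j) = refl
shuffle-coeff-0-0 (suc i) j = refl

shuffle-coeff-0-suc : ∀ c i j → δ 0 (suc c) i j ℚ.+ shift (shuffle-coeff 0 c) i j ≡ shuffle-coeff 0 (suc c) i j
shuffle-coeff-0-suc c zero j = trans (ℚ.+-identityʳ _)
  (trans (when-≡ (suc c ℕ.≟ j) (j ℕ.≟ suc c) 1ℚ sym sym) (cong (when (j ℕ.≟ suc c)) (sym fromℕ-1)))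
shuffle-coeff-0-suc c (suc i) j = trans (ℚ.+-identityˡ _)
  (when-≡ (i + j ℕ.≟ c) (suc i + j ℕ.≟ suc c) (fromℕ 1) (cong suc) ℕ.suc-injective)

shuffle-coeff-below : ∀ {m c i} j → i < m → shuffle-coeff m c i j ≡ 0ℚ
shuffle-coeff-below {m} {c} {i} j i<m =
  trans (cong (when (i + j ℕ.≟ m + c)) (trans (cong fromℕ (k>n⇒nCk≡0 i<m)) fromℕ-0)) (when-0 (i + j ℕ.≟ m + c))

shuffle-coeff-beyond : ∀ m {c i j} → c < j → shuffle-coeff m c i j ≡ 0ℚ
shuffle-coeff-beyond m {c} {i} {j} c<j with i + j ℕ.≟ m + c
... | yes i+j≡m+c = shuffle-coeff-below j (ℕ.+-cancelʳ-< c i m (subst (i + c <_) i+j≡m+c (ℕ.+-monoʳ-< i c<j)))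
... | no i+j≢m+c = when-no (i + j ℕ.≟ m + c) (fromℕ (i C m)) i+j≢m+c

shuffle-coeff-suc-0 : ∀ m i j → δ (suc m) 0 i j ≡ shuffle-coeff (suc m) 0 i j
shuffle-coeff-suc-0 m i j with suc m ℕ.≟ i | j
... | yes refl | zero = begin
  δ (suc m) 0 (suc m) 0                                 ≡⟨ δ-diagonal (suc m) 0 ⟩
  1ℚ                                                    ≡⟨ trans (cong fromℕ (nCn≡1 (suc m))) fromℕ-1 ⟨
  fromℕ (suc m C suc m)                                 ≡⟨ when-yes (suc m + 0 ℕ.≟ suc m + 0) (fromℕ (suc m C suc m)) refl ⟨
  shuffle-coeff (suc m) 0 (suc m) 0                     ∎
  where open ≡-Reasoning
... | yes refl | suc j = trans (δ-offʳ (suc m) (suc m) {0} {suc j} (λ ()))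
  (sym (when-no (suc m + suc j ℕ.≟ suc m + 0) (fromℕ (suc m C suc m))
    (ℕ.1+n≢0 ∘ ℕ.+-cancelˡ-≡ (suc m) (suc j) 0)))
... | no 1+m≢i | j = trans (δ-offˡ 0 j 1+m≢i) (sym vanish)
  where
  vanish : shuffle-coeff (suc m) 0 i j ≡ 0ℚ
  vanish with i + j ℕ.≟ suc m + 0
  ... | yes i+j≡1+m = shuffle-coeff-below j
    (ℕ.≤∧≢⇒< (subst (i ≤_) (trans i+j≡1+m (ℕ.+-identityʳ (suc m))) (ℕ.m≤m+n i j)) (1+m≢i ∘ sym))
  ... | no i+j≢1+m = when-no (i + j ℕ.≟ suc m + 0) (fromℕ (i C suc m)) i+j≢1+m

shuffle-coeff-pascal : ∀ m c i j →
  shift (shuffle-coeff m (suc c)) i j ℚ.+ shift (shuffle-coeff (suc m) c) i j ≡ shuffle-coeff (suc m) (suc c) i j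
shuffle-coeff-pascal m c zero j = sym (shuffle-coeff-below {suc m} {suc c} j (s≤s z≤n))
shuffle-coeff-pascal m c (suc i) j = begin
  when (i + j ℕ.≟ m + suc c) (fromℕ (i C m)) ℚ.+ when d (fromℕ (i C suc m))
    ≡⟨ cong (ℚ._+ when d (fromℕ (i C suc m))) (when-≡ (i + j ℕ.≟ m + suc c) d (fromℕ (i C m))
         (λ eq → trans eq (ℕ.+-suc m c)) (λ eq → trans eq (sym (ℕ.+-suc m c)))) ⟩
  when d (fromℕ (i C m)) ℚ.+ when d (fromℕ (i C suc m))
    ≡⟨ when-+ d (fromℕ (i C m)) (fromℕ (i C suc m)) ⟩
  when d (fromℕ (i C m) ℚ.+ fromℕ (i C suc m))
    ≡⟨ cong (when d) (trans (sym (fromℕ-+ (i C m) (i C suc m))) (cong fromℕ (nCk+nC[k+1]≡[n+1]C[k+1] i m))) ⟩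
  when d (fromℕ (suc i C suc m))
    ≡⟨ when-≡ d (suc i + j ℕ.≟ suc m + suc c) (fromℕ (suc i C suc m))
         (λ eq → cong suc (trans eq (sym (ℕ.+-suc m c)))) (λ eq → trans (ℕ.suc-injective eq) (ℕ.+-suc m c)) ⟩
  when (suc i + j ℕ.≟ suc m + suc c) (fromℕ (suc i C suc m)) ∎
  where
  open ≡-Reasoning
  d = i + j ℕ.≟ suc m + c

hook⧢e₁^ : ∀ m c → shW (hook m 0) (e₁^ c) ≈ₕ shuffle-coeff m c
hook⧢e₁^ zero zero = ≈ₕ-cong shuffle-coeff-0-0 (≈ₕ-hook 0 0)
hook⧢e₁^ zero (suc c) = ≈ₕ-cong (shuffle-coeff-0-suc c) (≈ₕ-++ (≈ₕ-hook 0 (suc c)) (≈ₕ-prefix (hook⧢e₁^ 0 c)))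
hook⧢e₁^ (suc m) zero = ≈ₕ-cong (shuffle-coeff-suc-0 m) (≈ₕ-hook (suc m) 0)
hook⧢e₁^ (suc m) (suc c) =
  ≈ₕ-cong (shuffle-coeff-pascal m c) (≈ₕ-++ (≈ₕ-prefix (hook⧢e₁^ m (suc c))) (≈ₕ-prefix (hook⧢e₁^ (suc m) c)))

z₁^z₂⧢e₁^ : ∀ n k → shW (z₁^ n ++ z 2) (e₁^ k) ≈ₕ shuffle-coeff (suc n) k
z₁^z₂⧢e₁^ n k = subst (λ u → shW u (e₁^ k) ≈ₕ shuffle-coeff (suc n) k) (sym (z₁^z₂z₁^≡hook n 0)) (hook⧢e₁^ (suc n) k)

-- Lumped v q P: P is a list of multiples of the single word v with coefficients summing to q,
-- i.e. a representation of q · v.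
data Lumped (v : Word) : ℚ → Poly → Set where
  []  : Lumped v 0ℚ []
  _∷_ : ∀ {q P} r → Lumped v q P → Lumped v (r ℚ.+ q) ((r , v) ∷ P)

Lumped-reweigh : ∀ {v q q′ P} → q ≡ q′ → Lumped v q P → Lumped v q′ P
Lumped-reweigh refl L = L

Lumped-⟦⟧ : ∀ v → Lumped v 1ℚ ⟦ v ⟧
Lumped-⟦⟧ v = 1ℚ ∷ []

Lumped-++ : ∀ {v q q′ P P′} → Lumped v q P → Lumped v q′ P′ → Lumped v (q ℚ.+ q′) (P ++ P′)
Lumped-++ {q′ = q′} [] L′ = Lumped-reweigh (sym (ℚ.+-identityˡ q′)) L′
Lumped-++ {q′ = q′} (_∷_ {q} r L) L′ = Lumped-reweigh (sym (ℚ.+-assoc r q q′)) (r ∷ Lumped-++ L L′)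

Lumped-· : ∀ {v q P} s → Lumped v q P → Lumped v (s * q) (s · P)
Lumped-· s [] = Lumped-reweigh (sym (ℚ.*-zeroʳ s)) []
Lumped-· s (_∷_ {q} r L) = Lumped-reweigh (sym (ℚ.*-distribˡ-+ s r q)) ((s * r) ∷ Lumped-· s L)

Lumped-prefix : ∀ {v q P} x → Lumped v q P → Lumped (x ∷ v) q (prefix x P)
Lumped-prefix x [] = []
Lumped-prefix x (r ∷ L) = r ∷ Lumped-prefix x L

⟦⟧⧢-∷ : ∀ u r v P → ⟦ u ⟧ ⧢ ((r , v) ∷ P) ≡ (1ℚ * r) · shW u v ++ ⟦ u ⟧ ⧢ P
⟦⟧⧢-∷ u r v P = ++-assoc ((1ℚ * r) · shW u v) _ []

Lumped-⟦⟧⧢ : ∀ {u v x q r P} → Lumped v q P → Lumped x r (shW u v) → Lumped x (q * r) (⟦ u ⟧ ⧢ P)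
Lumped-⟦⟧⧢ {r = r} [] _ = Lumped-reweigh (sym (ℚ.*-zeroˡ r)) []
Lumped-⟦⟧⧢ {u} {v} {x} {r = r} (_∷_ {q} {P} s L) Lᵤᵥ =
  subst₂ (Lumped x) weight (sym (⟦⟧⧢-∷ u s v P)) (Lumped-++ (Lumped-· (1ℚ * s) Lᵤᵥ) (Lumped-⟦⟧⧢ {u} L Lᵤᵥ))
  where
  weight : 1ℚ * s * r ℚ.+ q * r ≡ (s ℚ.+ q) * r
  weight = trans (cong (λ t → t * r ℚ.+ q * r) (ℚ.*-identityˡ s)) (sym (ℚ.*-distribʳ-+ r s q))

coeff-⟦⟧⧢ : ∀ {u v q P} → Lumped v q P → ∀ w → coeff (⟦ u ⟧ ⧢ P) w ≡ q * coeff (shW u v) w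
coeff-⟦⟧⧢ {u} {v} [] w = sym (ℚ.*-zeroˡ (coeff (shW u v) w))
coeff-⟦⟧⧢ {u} {v} (_∷_ {q} {P} r L) w = begin
  coeff (⟦ u ⟧ ⧢ ((r , v) ∷ P)) w                       ≡⟨ cong (λ p → coeff p w) (⟦⟧⧢-∷ u r v P) ⟩
  coeff ((1ℚ * r) · shW u v ++ ⟦ u ⟧ ⧢ P) w             ≡⟨ coeff-++ ((1ℚ * r) · shW u v) (⟦ u ⟧ ⧢ P) w ⟩
  coeff ((1ℚ * r) · shW u v) w ℚ.+ coeff (⟦ u ⟧ ⧢ P) w ≡⟨ cong₂ ℚ._+_ (coeff-· (1ℚ * r) (shW u v) w) (coeff-⟦⟧⧢ {u} L w) ⟩
  1ℚ * r * c ℚ.+ q * c                                  ≡⟨ cong (λ t → t * c ℚ.+ q * c) (ℚ.*-identityˡ r) ⟩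
  r * c ℚ.+ q * c                                       ≡⟨ ℚ.*-distribʳ-+ c r q ⟨
  (r ℚ.+ q) * c                                         ∎
  where
  open ≡-Reasoning
  c = coeff (shW u v) w

≈ₕ-⟦⟧⧢ : ∀ {u v q P F} → Lumped v q P → shW u v ≈ₕ F → ⟦ u ⟧ ⧢ P ≈ₕ (λ i j → q * F i j)
≈ₕ-⟦⟧⧢ {u} {q = q} L uv≈F = coeff≡hook-series λ w →
  trans (coeff-⟦⟧⧢ {u} L w) (trans (cong (q *_) (coeff-≡ uv≈F w)) (hook-series-*ˡ q _ w))

shW-e₁-e₁^ : ∀ k → Lumped (e₁^ (suc k)) (fromℕ (suc k)) (shW (e₁ ∷ []) (e₁^ k))
shW-e₁-e₁^ zero = Lumped-reweigh (sym fromℕ-1) (Lumped-⟦⟧ (e₁ ∷ []))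
shW-e₁-e₁^ (suc k) = Lumped-reweigh (trans (cong (ℚ._+ fromℕ (suc k)) (sym fromℕ-1)) (sym (fromℕ-+ 1 (suc k))))
  (Lumped-++ (Lumped-⟦⟧ (e₁^ (2 + k))) (Lumped-prefix e₁ (shW-e₁-e₁^ k)))

z₁^⧢-Lumped : ∀ k → Lumped (e₁^ k) (fromℕ (k !)) (z₁^⧢ k)
z₁^⧢-Lumped zero = Lumped-reweigh (sym fromℕ-1) (Lumped-⟦⟧ [])
z₁^⧢-Lumped (suc k) = Lumped-reweigh weight
  (Lumped-⟦⟧⧢ {u = z 1} (z₁^⧢-Lumped k) (shW-e₁-e₁^ k))
  where
  weight : fromℕ (k !) * fromℕ (suc k) ≡ fromℕ (suc k !)
  weight = trans (ℚ.*-comm (fromℕ (k !)) (fromℕ (suc k))) (sym (fromℕ-* (suc k) (k !)))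

a+c∸k+k≡a+c : ∀ a {c k} → k ≤ c → a + c ∸ k + k ≡ a + c
a+c∸k+k≡a+c a {c} k≤c = ℕ.m∸n+n≡m (ℕ.≤-trans k≤c (ℕ.m≤n+m c a))

shuffle-coeff-diagonal : ∀ a c i j → j ≤ c →
  fromℕ ((a + c ∸ j + 1) C (c ∸ j)) * δ (suc (a + c ∸ j)) j i j ≡ shuffle-coeff (suc a) c i j
shuffle-coeff-diagonal a c i j j≤c with suc (a + c ∸ j) ℕ.≟ i
... | yes refl = begin
  B * δ (suc n) j (suc n) j            ≡⟨ cong (B *_) (δ-diagonal (suc n) j) ⟩
  B * 1ℚ                               ≡⟨ ℚ.*-identityʳ B ⟩
  fromℕ ((n + 1) C (c ∸ j))            ≡⟨ cong fromℕ binomial ⟩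
  fromℕ (suc n C suc a)                ≡⟨ when-yes (suc n + j ℕ.≟ suc a + c) _ (cong suc (a+c∸k+k≡a+c a j≤c)) ⟨
  shuffle-coeff (suc a) c (suc n) j    ∎
  where
  open ≡-Reasoning
  n = a + c ∸ j
  B = fromℕ ((n + 1) C (c ∸ j))
  n≡a+[c∸j] : n ≡ a + (c ∸ j)
  n≡a+[c∸j] = ℕ.+-∸-assoc a j≤c
  binomial : (n + 1) C (c ∸ j) ≡ suc n C suc a
  binomial = begin
    (n + 1) C (c ∸ j)               ≡⟨ cong (λ m → (m + 1) C (c ∸ j)) n≡a+[c∸j] ⟩
    (a + (c ∸ j) + 1) C (c ∸ j)     ≡⟨ cong (_C (c ∸ j)) (ℕ.+-comm (a + (c ∸ j)) 1) ⟩
    (suc a + (c ∸ j)) C (c ∸ j)     ≡⟨ C-symmetric (suc a) (c ∸ j) ⟩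
    (suc a + (c ∸ j)) C suc a       ≡⟨ cong (λ m → suc m C suc a) n≡a+[c∸j] ⟨
    suc n C suc a                   ∎
... | no 1+n≢i = begin
  B * δ (suc (a + c ∸ j)) j i j        ≡⟨ cong (B *_) (δ-offˡ j j 1+n≢i) ⟩
  B * 0ℚ                               ≡⟨ ℚ.*-zeroʳ B ⟩
  0ℚ                                   ≡⟨ when-no (i + j ℕ.≟ suc a + c) (fromℕ (i C suc a)) i+j≢1+a+c ⟨
  shuffle-coeff (suc a) c i j          ∎
  where
  open ≡-Reasoning
  B = fromℕ ((a + c ∸ j + 1) C (c ∸ j))
  i+j≢1+a+c : i + j ≢ suc a + c
  i+j≢1+a+c i+j≡1+a+c = 1+n≢i (ℕ.+-cancelʳ-≡ j _ i (trans (cong suc (a+c∸k+k≡a+c a j≤c)) (sym i+j≡1+a+c)))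

shuffle-coeff-expansion : ∀ a c i j →
  shuffle-coeff (suc a) c i j ≡ sumToℚ c (λ k → fromℕ ((a + c ∸ k + 1) C (c ∸ k)) * δ (suc (a + c ∸ k)) k i j)
shuffle-coeff-expansion a c i j =
  trans (column (j ℕ.≤? c)) (sym (δ-column-sum c (λ k → fromℕ ((a + c ∸ k + 1) C (c ∸ k))) (λ k → suc (a + c ∸ k)) i j))
  where
  column : (d : Dec (j ≤ c)) →
           shuffle-coeff (suc a) c i j ≡ when d (fromℕ ((a + c ∸ j + 1) C (c ∸ j)) * δ (suc (a + c ∸ j)) j i j)
  column (no j≰c) = shuffle-coeff-beyond (suc a) {c} {i} (ℕ.≰⇒> j≰c)
  column (yes j≤c) = sym (shuffle-coeff-diagonal a c i j j≤c)

δ-alternating-sum : ∀ a c i j → i + j ≡ suc (a + c) →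
  δ (suc a) c i j ≡ fromℕ (i C suc a) * sumToℚ c (λ l → sgn l * fromℕ ((i ∸ suc a) C l))
δ-alternating-sum a c i j i+j≡1+a+c with suc a ℕ.≤? i
... | no 1+a≰i = begin
  δ (suc a) c i j             ≡⟨ δ-offˡ c j (λ 1+a≡i → 1+a≰i (ℕ.≤-reflexive 1+a≡i)) ⟩
  0ℚ                          ≡⟨ ℚ.*-zeroˡ S ⟨
  0ℚ * S                      ≡⟨ cong (_* S) (trans (cong fromℕ (k>n⇒nCk≡0 (ℕ.≰⇒> 1+a≰i))) fromℕ-0) ⟨
  fromℕ (i C suc a) * S       ∎
  where
  open ≡-Reasoning
  S = sumToℚ c (λ l → sgn l * fromℕ ((i ∸ suc a) C l))
... | yes 1+a≤i = by-excess (i ∸ suc a) refl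
  where
  by-excess : ∀ d → i ∸ suc a ≡ d → δ (suc a) c i j ≡ fromℕ (i C suc a) * sumToℚ c (λ l → sgn l * fromℕ (d C l))
  by-excess zero i∸[1+a]≡d = begin
    δ (suc a) c i j                                        ≡⟨ δ-on 1+a≡i c≡j ⟩
    1ℚ                                                     ≡⟨ trans (cong fromℕ (nCn≡1 (suc a))) fromℕ-1 ⟨
    fromℕ (suc a C suc a)                                  ≡⟨ cong (λ m → fromℕ (m C suc a)) 1+a≡i ⟩
    fromℕ (i C suc a)                                      ≡⟨ ℚ.*-identityʳ (fromℕ (i C suc a)) ⟨
    fromℕ (i C suc a) * 1ℚ                                 ≡⟨ cong (fromℕ (i C suc a) *_) (alternating-sum-0 c) ⟨
    fromℕ (i C suc a) * sumToℚ c (λ l → sgn l * fromℕ (0 C l)) ∎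
    where
    open ≡-Reasoning
    1+a≡i : suc a ≡ i
    1+a≡i = trans (sym (ℕ.+-identityʳ (suc a))) (trans (cong (suc a +_) (sym i∸[1+a]≡d)) (ℕ.m+[n∸m]≡n 1+a≤i))
    c≡j : c ≡ j
    c≡j = ℕ.+-cancelˡ-≡ (suc a) c j (trans (sym i+j≡1+a+c) (cong (_+ j) (sym 1+a≡i)))
  by-excess (suc d) i∸[1+a]≡d = begin
    δ (suc a) c i j                                        ≡⟨ δ-offˡ c j (λ 1+a≡i → ℕ.<⇒≢ 1+a<i 1+a≡i) ⟩
    0ℚ                                                     ≡⟨ ℚ.*-zeroʳ (fromℕ (i C suc a)) ⟨
    fromℕ (i C suc a) * 0ℚ                                 ≡⟨ cong (fromℕ (i C suc a) *_) (ℚ.*-zeroʳ (sgn c)) ⟨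
    fromℕ (i C suc a) * (sgn c * 0ℚ)                        ≡⟨ cong (λ x → fromℕ (i C suc a) * (sgn c * x))
                                                                  (trans (cong fromℕ (k>n⇒nCk≡0 d<c)) fromℕ-0) ⟨
    fromℕ (i C suc a) * (sgn c * fromℕ (d C c))             ≡⟨ cong (fromℕ (i C suc a) *_) (alternating-sum d c) ⟨
    fromℕ (i C suc a) * sumToℚ c (λ l → sgn l * fromℕ (suc d C l)) ∎
    where
    open ≡-Reasoning
    i≡1+a+[1+d] : i ≡ suc a + suc d
    i≡1+a+[1+d] = trans (sym (ℕ.m+[n∸m]≡n 1+a≤i)) (cong (suc a +_) i∸[1+a]≡d)
    1+a<i : suc a < i
    1+a<i = subst (suc a <_) (sym i≡1+a+[1+d]) (ℕ.m<m+n (suc a) (s≤s z≤n))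
    1+d+j≡c : suc d + j ≡ c
    1+d+j≡c = ℕ.+-cancelˡ-≡ (suc a) (suc d + j) c
      (trans (sym (ℕ.+-assoc (suc a) (suc d) j)) (trans (cong (_+ j) (sym i≡1+a+[1+d])) i+j≡1+a+c))
    d<c : d < c
    d<c = subst (d <_) 1+d+j≡c (s≤s (ℕ.m≤m+n d j))

inv!-cancel : ∀ s k b x → (s * inv! k * b) * (fromℕ (k !) * x) ≡ s * (b * x)
inv!-cancel s k b x = begin
  (s * inv! k * b) * (fromℕ (k !) * x)   ≡⟨ solve 5 (λ s v b f x → (s :* v :* b) :* (f :* x) := s :* (b :* x) :* (v :* f))
                                                   refl s (inv! k) b (fromℕ (k !)) x ⟩
  s * (b * x) * (inv! k * fromℕ (k !))   ≡⟨ cong (s * (b * x) *_) (inv!-*-fromℕ! k) ⟩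
  s * (b * x) * 1ℚ                       ≡⟨ ℚ.*-identityʳ (s * (b * x)) ⟩
  s * (b * x)                            ∎
  where
  open ≡-Reasoning
  open +-*-Solver

signed-shuffle-sum : ℕ → ℕ → ℕ → ℕ → ℚ
signed-shuffle-sum a c i j =
  sumToℚ c (λ k → sgn (c ∸ k) * (fromℕ ((a + c ∸ k + 1) C (c ∸ k)) * shuffle-coeff (suc (a + c ∸ k)) k i j))

signed-shuffle-sum-off : ∀ a c i j → i + j ≢ suc (a + c) → signed-shuffle-sum a c i j ≡ 0ℚ
signed-shuffle-sum-off a c i j i+j≢1+a+c = sumToℚ-zero c λ k k≤c → begin
  sgn (c ∸ k) * (b k * shuffle-coeff (suc (a + c ∸ k)) k i j)
    ≡⟨ cong (λ x → sgn (c ∸ k) * (b k * x)) (when-no (i + j ℕ.≟ suc (a + c ∸ k) + k) _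
         λ eq → i+j≢1+a+c (trans eq (cong suc (a+c∸k+k≡a+c a k≤c)))) ⟩
  sgn (c ∸ k) * (b k * 0ℚ)
    ≡⟨ trans (cong (sgn (c ∸ k) *_) (ℚ.*-zeroʳ (b k))) (ℚ.*-zeroʳ (sgn (c ∸ k))) ⟩
  0ℚ ∎
  where
  open ≡-Reasoning
  b : ℕ → ℚ
  b k = fromℕ ((a + c ∸ k + 1) C (c ∸ k))

signed-shuffle-sum-on : ∀ a c i j → i + j ≡ suc (a + c) →
  signed-shuffle-sum a c i j ≡ fromℕ (i C suc a) * sumToℚ c (λ l → sgn l * fromℕ ((i ∸ suc a) C l))
signed-shuffle-sum-on a c i j i+j≡1+a+c = begin
  signed-shuffle-sum a c i j
    ≡⟨ sumToℚ-cong c (λ k k≤c → cong (sgn (c ∸ k) *_) (reindexed k k≤c)) ⟩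
  sumToℚ c (λ k → g (c ∸ k))
    ≡⟨ sumToℚ-reverse c g ⟩
  sumToℚ c g
    ≡⟨ sumToℚ-cong c (λ l _ → revised l) ⟩
  sumToℚ c (λ l → fromℕ (i C suc a) * (sgn l * fromℕ ((i ∸ suc a) C l)))
    ≡⟨ sumToℚ-*ˡ c (fromℕ (i C suc a)) (λ l → sgn l * fromℕ ((i ∸ suc a) C l)) ⟩
  fromℕ (i C suc a) * sumToℚ c (λ l → sgn l * fromℕ ((i ∸ suc a) C l)) ∎
  where
  open ≡-Reasoning
  open +-*-Solver
  g : ℕ → ℚ
  g l = sgn l * fromℕ (((a + l + 1) C l) ℕ.* (i C suc (a + l)))
  reindexed : ∀ k → k ≤ c → fromℕ ((a + c ∸ k + 1) C (c ∸ k)) * shuffle-coeff (suc (a + c ∸ k)) k i j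
                           ≡ fromℕ (((a + (c ∸ k) + 1) C (c ∸ k)) ℕ.* (i C suc (a + (c ∸ k))))
  reindexed k k≤c = begin
    fromℕ ((a + c ∸ k + 1) C (c ∸ k)) * shuffle-coeff (suc (a + c ∸ k)) k i j
      ≡⟨ cong (fromℕ ((a + c ∸ k + 1) C (c ∸ k)) *_) (when-yes (i + j ℕ.≟ suc (a + c ∸ k) + k) _
           (trans i+j≡1+a+c (sym (cong suc (a+c∸k+k≡a+c a k≤c))))) ⟩
    fromℕ ((a + c ∸ k + 1) C (c ∸ k)) * fromℕ (i C suc (a + c ∸ k))
      ≡⟨ fromℕ-* ((a + c ∸ k + 1) C (c ∸ k)) (i C suc (a + c ∸ k)) ⟨
    fromℕ (((a + c ∸ k + 1) C (c ∸ k)) ℕ.* (i C suc (a + c ∸ k)))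
      ≡⟨ cong (λ n → fromℕ (((n + 1) C (c ∸ k)) ℕ.* (i C suc n))) (ℕ.+-∸-assoc a k≤c) ⟩
    fromℕ (((a + (c ∸ k) + 1) C (c ∸ k)) ℕ.* (i C suc (a + (c ∸ k)))) ∎
  revised : ∀ l → g l ≡ fromℕ (i C suc a) * (sgn l * fromℕ ((i ∸ suc a) C l))
  revised l = begin
    sgn l * fromℕ (((a + l + 1) C l) ℕ.* (i C suc (a + l)))
      ≡⟨ cong (λ n → sgn l * fromℕ ((n C l) ℕ.* (i C suc (a + l)))) (ℕ.+-comm (a + l) 1) ⟩
    sgn l * fromℕ (((suc a + l) C l) ℕ.* (i C (suc a + l)))
      ≡⟨ cong (λ n → sgn l * fromℕ n) (C-trinomial-revision (suc a) l i) ⟩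
    sgn l * fromℕ ((i C suc a) ℕ.* ((i ∸ suc a) C l))
      ≡⟨ cong (sgn l *_) (fromℕ-* (i C suc a) ((i ∸ suc a) C l)) ⟩
    sgn l * (fromℕ (i C suc a) * fromℕ ((i ∸ suc a) C l))
      ≡⟨ solve 3 (λ s x y → s :* (x :* y) := x :* (s :* y)) refl (sgn l) (fromℕ (i C suc a)) (fromℕ ((i ∸ suc a) C l)) ⟩
    fromℕ (i C suc a) * (sgn l * fromℕ ((i ∸ suc a) C l)) ∎

δ≡signed-shuffle-sum : ∀ a c i j → δ (suc a) c i j ≡ signed-shuffle-sum a c i j
δ≡signed-shuffle-sum a c i j with i + j ℕ.≟ suc (a + c)
... | yes i+j≡1+a+c = trans (δ-alternating-sum a c i j i+j≡1+a+c) (sym (signed-shuffle-sum-on a c i j i+j≡1+a+c))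
... | no i+j≢1+a+c = trans δ≡0 (sym (signed-shuffle-sum-off a c i j i+j≢1+a+c))
  where
  δ≡0 : δ (suc a) c i j ≡ 0ℚ
  δ≡0 with suc a ℕ.≟ i
  ... | yes refl = δ-offʳ (suc a) (suc a) λ c≡j → i+j≢1+a+c (cong (suc a +_) (sym c≡j))
  ... | no 1+a≢i = δ-offˡ c j 1+a≢i

δ-inversion : ∀ a c i j →
  δ (suc a) c i j ≡ sumToℚ c (λ k → (sgn (c ∸ k) * inv! k * fromℕ ((a + c ∸ k + 1) C (c ∸ k)))
                                    * (fromℕ (k !) * shuffle-coeff (suc (a + c ∸ k)) k i j))
δ-inversion a c i j = trans (δ≡signed-shuffle-sum a c i j) (sumToℚ-cong c λ k _ →
  sym (inv!-cancel (sgn (c ∸ k)) k (fromℕ ((a + c ∸ k + 1) C (c ∸ k))) (shuffle-coeff (suc (a + c ∸ k)) k i j)))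

shuffle-formula : (a c : ℕ) →
  ⟦ z₁^ a ++ z 2 ⟧ ⧢ ⟦ z₁^ c ⟧ ≈ sumTo c (λ k → binQ (a + c ∸ k + 1) (c ∸ k) · ⟦ z₁^ (a + c ∸ k) ++ z 2 ++ z₁^ k ⟧)
shuffle-formula a c = ≈ₕ⇒≈
  (≈ₕ-⟦⟧⧢ {u = z₁^ a ++ z 2} (Lumped-⟦⟧ (z₁^ c))
    (subst (λ v → shW (z₁^ a ++ z 2) v ≈ₕ shuffle-coeff (suc a) c) (sym (z₁^≡e₁^ c)) (z₁^z₂⧢e₁^ a c)))
  (≈ₕ-sumTo c λ k → ≈ₕ-· (binQ (a + c ∸ k + 1) (c ∸ k)) (≈ₕ-z₁^z₂z₁^ (a + c ∸ k) k))
  λ i j → trans (ℚ.*-identityˡ (shuffle-coeff (suc a) c i j)) (trans (shuffle-coeff-expansion a c i j)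
    (sumToℚ-cong c λ k _ → cong (_* δ (suc (a + c ∸ k)) k i j) (sym (binQ≡fromℕ (a + c ∸ k + 1) (c ∸ k)))))

inversion-formula : (a c : ℕ) →
  ⟦ z₁^ a ++ z 2 ++ z₁^ c ⟧
    ≈ sumTo c (λ k → (sgn (c ∸ k) * inv! k * binQ (a + c ∸ k + 1) (c ∸ k)) · (⟦ z₁^ (a + c ∸ k) ++ z 2 ⟧ ⧢ z₁^⧢ k))
inversion-formula a c = ≈ₕ⇒≈
  (≈ₕ-z₁^z₂z₁^ a c)
  (≈ₕ-sumTo c λ k → ≈ₕ-· (sgn (c ∸ k) * inv! k * binQ (a + c ∸ k + 1) (c ∸ k))
    (≈ₕ-⟦⟧⧢ {u = z₁^ (a + c ∸ k) ++ z 2} (z₁^⧢-Lumped k) (z₁^z₂⧢e₁^ (a + c ∸ k) k)))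
  λ i j → trans (δ-inversion a c i j) (sumToℚ-cong c λ k _ →
    cong (λ x → (sgn (c ∸ k) * inv! k * x) * (fromℕ (k !) * shuffle-coeff (suc (a + c ∸ k)) k i j))
         (sym (binQ≡fromℕ (a + c ∸ k + 1) (c ∸ k))))

lemmaA3 : (a c : ℕ) →
    (⟦ z₁^ a ++ z 2 ⟧ ⧢ ⟦ z₁^ c ⟧
      ≈ sumTo c (λ k → binQ (a + c ∸ k + 1) (c ∸ k) · ⟦ z₁^ (a + c ∸ k) ++ z 2 ++ z₁^ k ⟧))
    × (⟦ z₁^ a ++ z 2 ++ z₁^ c ⟧
      ≈ sumTo c (λ k → (sgn (c ∸ k) * inv! k * binQ (a + c ∸ k + 1) (c ∸ k)) · (⟦ z₁^ (a + c ∸ k) ++ z 2 ⟧ ⧢ z₁^⧢ k)))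
lemmaA3 a c = shuffle-formula a c , inversion-formula a c
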